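{- Let $G$ be a finite connected graph. (i) If $G$ is cubic and has girth at least 5, then $G$ is sober and $\mathrm{c\text{ - }rk}\,G=3$. (ii) If $G=(V,E)$ is sober, connected and $\mathrm{c\text{ - }rk}\,G=3$, then $|\mathrm{St}(v)\cap\mathrm{St}(w)|\le1$ for all distinct $v,w\in V$.
   Context: Graphs are finite, undirected, without loops or multiple edges; cubic means all degrees are 3; the girth is the length of a shortest cycle. $\mathrm{St}(v)$ is the set of neighbours of $v$; $G$ is sober if $v\mapsto\mathrm{St}(v)$ is injective. $\mathrm{c\text{ - }rk}\,G$ is the maximum number of independent columns of the $V\times V$ boolean matrix $A^c$ (entry $0$ if $\{i,j\}\in E$, else $1$), where vectors over the superboolean semiring $\{0,1,1^\nu\}$ (with $0+x=x$, $1+1=1^\nu$, $1^\nu+x=1^\nu$, $0\cdot x=0$, $1\cdot1=1$, $1\cdot1^\nu=1^\nu\cdot1^\nu=1^\nu$) are dependent if some $\{0,1\}$-combination with not all coefficients zero has all coordinates in $\{0,1^\nu\}$, and independent otherwise. -}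

module Defs where

open import Data.Nat using (ℕ; zero; suc; _≤_)
open import Data.Bool using (Bool; true; false)
open import Data.Fin using (Fin)
open import Data.Fin.Subset using (Subset; _∈_; ∣_∣)
open import Data.Vec using (tabulate)
open import Data.List using (List; []; _∷_; _++_; [_]; length)
open import Data.List.Relation.Unary.Linked using (Linked)
open import Data.List.Relation.Unary.Unique.Propositional using (Unique)
open import Data.Product using (Σ; _×_; ∃)
open import Relation.Binary.PropositionalEquality using (_≡_; _≢_)
open import Relation.Nullary using (¬_)

record Graph : Set where
  field
    n      : ℕ
    adj    : Fin n → Fin n → Bool
    sym    : ∀ u v → adj u v ≡ adj v u
    irrefl : ∀ v → adj v v ≡ false

open Graph public

Adj : (G : Graph) → Fin (n G) → Fin (n G) → Set
Adj G u v = adj G u v ≡ true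

St : (G : Graph) → Fin (n G) → Subset (n G)
St G v = tabulate (adj G v)

-- connectivity: nonempty and any two vertices are joined by a walk
data Reach (G : Graph) : Fin (n G) → Fin (n G) → Set where
  here : ∀ {v} → Reach G v v
  step : ∀ {u v w} → Adj G u v → Reach G v w → Reach G u w

Connected : Graph → Set
Connected G = Fin (n G) × (∀ u v → Reach G u v)

Cubic : Graph → Set
Cubic G = ∀ v → ∣ St G v ∣ ≡ 3

IsCycle : (G : Graph) → List (Fin (n G)) → Set
IsCycle G []       = Data.Empty.⊥
  where import Data.Empty
IsCycle G (x ∷ xs) =
  3 ≤ length (x ∷ xs) × Unique (x ∷ xs) × Linked (Adj G) (x ∷ xs ++ [ x ])

GirthAtLeast : Graph → ℕ → Set
GirthAtLeast G k = ∀ c → IsCycle G c → k ≤ length c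

Sober : Graph → Set
Sober G = ∀ v w → St G v ≡ St G w → v ≡ w

data SB : Set where
  𝟘 𝟙 𝟙ν : SB

infixl 6 _⊕_
infixl 7 _⊗_

_⊕_ : SB → SB → SB
𝟘  ⊕ x  = x
𝟙  ⊕ 𝟘  = 𝟙
𝟙  ⊕ 𝟙  = 𝟙ν
𝟙  ⊕ 𝟙ν = 𝟙ν
𝟙ν ⊕ x  = 𝟙ν

_⊗_ : SB → SB → SB
𝟘  ⊗ x  = 𝟘
𝟙  ⊗ 𝟘  = 𝟘
𝟙  ⊗ 𝟙  = 𝟙
𝟙  ⊗ 𝟙ν = 𝟙ν
𝟙ν ⊗ 𝟘  = 𝟘
𝟙ν ⊗ 𝟙  = 𝟙ν
𝟙ν ⊗ 𝟙ν = 𝟙ν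

bool→SB : Bool → SB
bool→SB false = 𝟘
bool→SB true  = 𝟙

sumSB : ∀ {m} → (Fin m → SB) → SB
sumSB {zero}  f = 𝟘
sumSB {suc m} f = f Fin.zero ⊕ sumSB (λ j → f (Fin.suc j))
  where import Data.Fin as Fin

Ghost : SB → Set
Ghost x = ¬ (x ≡ 𝟙)

Ac : (G : Graph) → Fin (n G) → Fin (n G) → SB
Ac G i j with adj G i j
... | true  = 𝟘
... | false = 𝟙

Dependent : (G : Graph) → Subset (n G) → Set
Dependent G S =
  Σ (Fin (n G) → Bool) λ c →
    (∀ j → c j ≡ true → j ∈ S) ×
    (∃ λ j → c j ≡ true) ×
    (∀ i → Ghost (sumSB (λ j → Ac G i j ⊗ bool→SB (c j))))

Independent : (G : Graph) → Subset (n G) → Set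
Independent G S = ¬ Dependent G S

CRank : Graph → ℕ → Set
CRank G k =
  (Σ (Subset (n G)) λ S → Independent G S × ∣ S ∣ ≡ k) ×
  (∀ S → Independent G S → ∣ S ∣ ≤ k)

module Submission where

-- A {0,1}-combination of columns of A^c is a subset C of vertices; its i-th
-- coordinate is the saturated count (0, 1 or 1^ν) of the members of C that
-- are not adjacent to i.  So a set S of columns is dependent iff it contains a
-- nonempty "ghost set" C: no vertex is non-adjacent to exactly one member
-- of C (dependent⁺ / dependent⁻).
--
-- Independent sets are built by one extension principle: if S is independent
-- and S ⊆ St(i) while x ∉ St(i), then {x} ∪ S is independent, since row i
-- detects every combination using x (extend).  In a sober graph a vertex
-- adjacent to exactly one of y ≠ z makes {y, z} independent.
--
-- (ii) If v ≠ w had two common neighbours a, b, take x adjacent to exactly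
-- one of v, w, say to v; then {v, x, a, b} is independent of size 4.
-- (i) Girth ≥ 5 forbids 4-cycles, so distinct vertices share at most one
-- neighbour; this gives soberness, and {v, a, b} (a, b neighbours of v) is
-- independent of size 3.  A set S of size ≥ 4 is dependent: if some St(i)
-- lies in S, St(i) is a ghost set (every k ≠ i misses at least two of the
-- three neighbours of i), and otherwise S itself is (every k has at most two
-- neighbours in S, hence misses at least two members of S).

open import Defs
open import Data.Nat using (ℕ; zero; suc; _+_; _≤_; _<_; z≤n; s≤s; s≤s⁻¹)
open import Data.Nat.Properties
  using (+-suc; +-comm; ≤-trans; _≤?_; ≰⇒>; n≢0⇒n>0; +-monoˡ-≤; +-monoʳ-≤; +-cancelˡ-≤)
open import Data.Bool using (Bool; true; false; not)
import Data.Bool.Properties as Bool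
open import Data.Fin using (Fin; _≟_) renaming (zero to fzero; suc to fsuc)
open import Data.Fin.Properties using (¬∀⟶∃¬; any?; suc-injective)
open import Data.Fin.Subset
  using (Subset; _∈_; _∉_; _⊆_; _∩_; _∪_; _─_; ⁅_⁆; ∣_∣; Nonempty) renaming (⊥ to ∅)
open import Data.Fin.Subset.Properties
  using ( _∈?_; _⊆?_; ∉⊥; ∣⊥∣≡0; ∣⁅x⁆∣≡1; x∈⁅x⁆; x∈⁅y⁆⇒x≡y; x∈p∩q⁻; x∈p∪q⁻
        ; x∈p∧x∉q⇒x∈p─q; p─q⊆p; x∈p⇒∣p-x∣<∣p∣; ⊆-antisym; Empty-unique
        ; ∩-comm; ∪-comm; ∪-identityˡ; ∪-identityʳ)
open import Data.Vec using ([]; _∷_; here; there; tabulate; lookup)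
open import Data.Vec.Properties
  using (lookup∘tabulate; tabulate∘lookup; tabulate-cong; []=⇒lookup; lookup⇒[]=)
open import Data.List using ([]; _∷_)
open import Data.List.Relation.Unary.All using ([]; _∷_)
open import Data.List.Relation.Unary.AllPairs using ([]; _∷_)
open import Data.List.Relation.Unary.Linked using (Linked; [-]; _∷_)
open import Data.List.Relation.Unary.Unique.Propositional using (Unique)
open import Data.Product using (∃; ∃₂; _×_; _,_)
open import Data.Sum using (_⊎_; inj₁; inj₂)
open import Data.Empty using (⊥; ⊥-elim)
open import Function using (_∘_; id)
open import Relation.Nullary using (¬_; yes; no)
import Relation.Binary.PropositionalEquality as ≡
open ≡ using (_≡_; _≢_; refl; cong; subst; subst₂)

private variable
  m : ℕ
  x y : Fin m
  p q : Subset m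

∣p∣≡∣p∩q∣+∣p─q∣ : (p q : Subset m) → ∣ p ∣ ≡ ∣ p ∩ q ∣ + ∣ p ─ q ∣
∣p∣≡∣p∩q∣+∣p─q∣ []          []          = refl
∣p∣≡∣p∩q∣+∣p─q∣ (true  ∷ p) (true  ∷ q) = cong suc (∣p∣≡∣p∩q∣+∣p─q∣ p q)
∣p∣≡∣p∩q∣+∣p─q∣ (true  ∷ p) (false ∷ q) =
  ≡.trans (cong suc (∣p∣≡∣p∩q∣+∣p─q∣ p q)) (≡.sym (+-suc ∣ p ∩ q ∣ ∣ p ─ q ∣))
∣p∣≡∣p∩q∣+∣p─q∣ (false ∷ p) (true  ∷ q) = ∣p∣≡∣p∩q∣+∣p─q∣ p q
∣p∣≡∣p∩q∣+∣p─q∣ (false ∷ p) (false ∷ q) = ∣p∣≡∣p∩q∣+∣p─q∣ p q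

x∈p⇒1≤∣p∣ : x ∈ p → 1 ≤ ∣ p ∣
x∈p⇒1≤∣p∣ x∈p = ≤-trans (s≤s z≤n) (x∈p⇒∣p-x∣<∣p∣ x∈p)

1≤∣p∣⇒nonempty : (p : Subset m) → 1 ≤ ∣ p ∣ → Nonempty p
1≤∣p∣⇒nonempty (true  ∷ p) _ = fzero , here
1≤∣p∣⇒nonempty (false ∷ p) h with 1≤∣p∣⇒nonempty p h
... | x , x∈p = fsuc x , there x∈p

2≤∣p∣⇒distinct : (p : Subset m) → 2 ≤ ∣ p ∣ → ∃₂ λ x y → x ≢ y × x ∈ p × y ∈ p
2≤∣p∣⇒distinct (true ∷ p) (s≤s h) with 1≤∣p∣⇒nonempty p h
... | y , y∈p = fzero , fsuc y , (λ ()) , here , there y∈p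
2≤∣p∣⇒distinct (false ∷ p) h with 2≤∣p∣⇒distinct p h
... | x , y , x≢y , x∈p , y∈p = fsuc x , fsuc y , x≢y ∘ suc-injective , there x∈p , there y∈p

no-two⇒∣p∣≤1 : (p : Subset m) → (∀ {x y} → x ≢ y → x ∈ p → y ∈ p → ⊥) → ∣ p ∣ ≤ 1
no-two⇒∣p∣≤1 p no-two with ∣ p ∣ ≤? 1
... | yes few  = few
... | no  many with 2≤∣p∣⇒distinct p (≰⇒> many)
...   | x , y , x≢y , x∈p , y∈p = ⊥-elim (no-two x≢y x∈p y∈p)

only⇒∣p∣≡1 : x ∈ p → (∀ {y} → y ∈ p → y ≡ x) → ∣ p ∣ ≡ 1
only⇒∣p∣≡1 {x = x} x∈p only = ≡.trans (cong ∣_∣ (⊆-antisym p⊆⁅x⁆ ⁅x⁆⊆p)) (∣⁅x⁆∣≡1 x)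
  where
  p⊆⁅x⁆ : _ ⊆ ⁅ x ⁆
  p⊆⁅x⁆ y∈p = subst (_∈ ⁅ x ⁆) (≡.sym (only y∈p)) (x∈⁅x⁆ x)
  ⁅x⁆⊆p : ⁅ x ⁆ ⊆ _
  ⁅x⁆⊆p y∈⁅x⁆ = subst (_∈ _) (≡.sym (x∈⁅y⁆⇒x≡y x y∈⁅x⁆)) x∈p

∣⁅x⁆∪p∣≡1+∣p∣ : x ∉ p → ∣ ⁅ x ⁆ ∪ p ∣ ≡ suc ∣ p ∣
∣⁅x⁆∪p∣≡1+∣p∣ {x = fzero}  {p = true  ∷ p} x∉p = ⊥-elim (x∉p here)
∣⁅x⁆∪p∣≡1+∣p∣ {x = fzero}  {p = false ∷ p} _   = cong (suc ∘ ∣_∣) (∪-identityˡ p)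
∣⁅x⁆∪p∣≡1+∣p∣ {x = fsuc x} {p = true  ∷ p} x∉p = cong suc (∣⁅x⁆∪p∣≡1+∣p∣ (x∉p ∘ there))
∣⁅x⁆∪p∣≡1+∣p∣ {x = fsuc x} {p = false ∷ p} x∉p = ∣⁅x⁆∪p∣≡1+∣p∣ (x∉p ∘ there)

⁅x⁆⊆q : x ∈ q → ⁅ x ⁆ ⊆ q
⁅x⁆⊆q {x = x} x∈q y∈⁅x⁆ = subst (_∈ _) (≡.sym (x∈⁅y⁆⇒x≡y x y∈⁅x⁆)) x∈q

⁅x⁆∪p⊆q : x ∈ q → p ⊆ q → ⁅ x ⁆ ∪ p ⊆ q
⁅x⁆∪p⊆q {x = x} {p = p} x∈q p⊆q y∈ with x∈p∪q⁻ ⁅ x ⁆ p y∈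
... | inj₁ y∈⁅x⁆ = ⁅x⁆⊆q x∈q y∈⁅x⁆
... | inj₂ y∈p   = p⊆q y∈p

x∈p─q⇒x∉q : x ∈ p ─ q → x ∉ q
x∈p─q⇒x∉q {p = _ ∷ p} {q = true  ∷ q} (there x∈) (there x∈q) = x∈p─q⇒x∉q x∈ x∈q
x∈p─q⇒x∉q {p = _ ∷ p} {q = false ∷ q} (there x∈) (there x∈q) = x∈p─q⇒x∉q x∈ x∈q

∣p─p∣≡0 : (p : Subset m) → ∣ p ─ p ∣ ≡ 0
∣p─p∣≡0 {m} p = ≡.trans (cong ∣_∣ (Empty-unique λ (y , y∈) → x∈p─q⇒x∉q y∈ (p─q⊆p p p y∈))) (∣⊥∣≡0 m)

∣p─q∣≡0⇒p⊆q : ∣ p ─ q ∣ ≡ 0 → p ⊆ q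
∣p─q∣≡0⇒p⊆q {q = q} e {x} x∈p with x ∈? q
... | yes x∈q = x∈q
... | no  x∉q with subst (1 ≤_) e (x∈p⇒1≤∣p∣ (x∈p∧x∉q⇒x∈p─q x∈p x∉q))
...   | ()

p⊈q⇒∣p∩q∣<∣p∣ : (p q : Subset m) → ¬ p ⊆ q → ∣ p ∩ q ∣ < ∣ p ∣
p⊈q⇒∣p∩q∣<∣p∣ p q p⊈q =
  subst₂ _≤_ (+-comm ∣ p ∩ q ∣ 1) (≡.sym (∣p∣≡∣p∩q∣+∣p─q∣ p q))
    (+-monoʳ-≤ ∣ p ∩ q ∣ (n≢0⇒n>0 (p⊈q ∘ ∣p─q∣≡0⇒p⊆q)))

∣p─q∣≢1 : (p q : Subset m) → ∣ p ∩ q ∣ + 2 ≤ ∣ p ∣ → ∣ p ─ q ∣ ≢ 1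
∣p─q∣≢1 p q big one
  with +-cancelˡ-≤ ∣ p ∩ q ∣ 2 1
         (subst (∣ p ∩ q ∣ + 2 ≤_) (≡.trans (∣p∣≡∣p∩q∣+∣p─q∣ p q) (cong (∣ p ∩ q ∣ +_) one)) big)
... | s≤s ()

∈tabulate⁻ : (f : Fin m → Bool) → x ∈ tabulate f → f x ≡ true
∈tabulate⁻ {x = x} f x∈ = ≡.trans (≡.sym (lookup∘tabulate f x)) ([]=⇒lookup x∈)

∈tabulate⁺ : (f : Fin m → Bool) → f x ≡ true → x ∈ tabulate f
∈tabulate⁺ {x = x} f fx = lookup⇒[]= x (tabulate f) (≡.trans (lookup∘tabulate f x) fx)

-- The value in SB of a sum of k ones: 0, 1, and the ghost 1^ν once k ≥ 2.
ofℕ : ℕ → SB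
ofℕ zero          = 𝟘
ofℕ (suc zero)    = 𝟙
ofℕ (suc (suc _)) = 𝟙ν

𝟙⊕ofℕ : ∀ k → 𝟙 ⊕ ofℕ k ≡ ofℕ (suc k)
𝟙⊕ofℕ zero          = refl
𝟙⊕ofℕ (suc zero)    = refl
𝟙⊕ofℕ (suc (suc _)) = refl

ghost-ofℕ⁻ : ∀ {k} → Ghost (ofℕ k) → k ≢ 1
ghost-ofℕ⁻ ghost refl = ghost refl

ghost-ofℕ⁺ : ∀ k → k ≢ 1 → Ghost (ofℕ k)
ghost-ofℕ⁺ zero          _   ()
ghost-ofℕ⁺ (suc zero)    k≢1 _ = k≢1 refl
ghost-ofℕ⁺ (suc (suc _)) _   ()

sum-missed : (e : Fin m → SB) (c g : Fin m → Bool) → (∀ j → e j ≡ bool→SB (not (g j))) →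
             sumSB (λ j → e j ⊗ bool→SB (c j)) ≡ ofℕ ∣ tabulate c ─ tabulate g ∣
sum-missed {zero}  e c g e≡ = refl
sum-missed {suc m} e c g e≡ rewrite e≡ fzero with g fzero | c fzero
... | true  | _     = sum-missed (e ∘ fsuc) (c ∘ fsuc) (g ∘ fsuc) (e≡ ∘ fsuc)
... | false | false = sum-missed (e ∘ fsuc) (c ∘ fsuc) (g ∘ fsuc) (e≡ ∘ fsuc)
... | false | true  =
  ≡.trans (cong (𝟙 ⊕_) (sum-missed (e ∘ fsuc) (c ∘ fsuc) (g ∘ fsuc) (e≡ ∘ fsuc))) (𝟙⊕ofℕ _)

module _ (G : Graph) where

  ∈St⁻ : ∀ {i x} → x ∈ St G i → Adj G i x
  ∈St⁻ {i} = ∈tabulate⁻ (adj G i)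

  ∈St⁺ : ∀ {i x} → Adj G i x → x ∈ St G i
  ∈St⁺ {i} = ∈tabulate⁺ (adj G i)

  ∉St⁺ : ∀ {i x} → adj G i x ≡ false → x ∉ St G i
  ∉St⁺ i≁x x∈ with ≡.trans (≡.sym (∈St⁻ x∈)) i≁x
  ... | ()

  St-sym : ∀ {x y} → x ∈ St G y → y ∈ St G x
  St-sym {x} {y} x∈ = ∈St⁺ (≡.trans (sym G x y) (∈St⁻ x∈))

  ∉St-self : ∀ v → v ∉ St G v
  ∉St-self v = ∉St⁺ (irrefl G v)

  ∈St⇒≢ : ∀ {v x} → x ∈ St G v → v ≢ x
  ∈St⇒≢ {v} x∈ refl = ∉St-self v x∈

  Ac-entry : ∀ i j → Ac G i j ≡ bool→SB (not (adj G i j))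
  Ac-entry i j with adj G i j
  ... | true  = refl
  ... | false = refl

  row-sum : ∀ (c : Fin (n G) → Bool) i →
            sumSB (λ j → Ac G i j ⊗ bool→SB (c j)) ≡ ofℕ ∣ tabulate c ─ St G i ∣
  row-sum c i = sum-missed (Ac G i) c (adj G i) (Ac-entry i)

  -- C is a ghost set when no vertex is non-adjacent to exactly one member of
  -- C, i.e. every coordinate of the sum of the columns indexed by C is ghost.
  GhostSet : Subset (n G) → Set
  GhostSet C = ∀ i → ∣ C ─ St G i ∣ ≢ 1

  dependent⁻ : ∀ {S} → Dependent G S → ∃ λ C → C ⊆ S × Nonempty C × GhostSet C
  dependent⁻ (c , c⊆S , (j , cj) , ghost) =
    tabulate c , (λ j∈ → c⊆S _ (∈tabulate⁻ c j∈)) , (j , ∈tabulate⁺ c cj) ,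
    λ i → ghost-ofℕ⁻ (subst Ghost (row-sum c i) (ghost i))

  dependent⁺ : ∀ {S C} → C ⊆ S → Nonempty C → GhostSet C → Dependent G S
  dependent⁺ {C = C} C⊆S (j , j∈C) ghost =
    lookup C , (λ k Ck → C⊆S (lookup⇒[]= k C Ck)) , (j , []=⇒lookup j∈C) ,
    λ i → subst Ghost (≡.sym (row-sum-C i)) (ghost-ofℕ⁺ _ (ghost i))
    where
    row-sum-C : ∀ i → sumSB (λ j → Ac G i j ⊗ bool→SB (lookup C j)) ≡ ofℕ ∣ C ─ St G i ∣
    row-sum-C i =
      ≡.trans (row-sum (lookup C) i) (cong (λ D → ofℕ ∣ D ─ St G i ∣) (tabulate∘lookup C))

  IndependentSet : Subset (n G) → ℕ → Set
  IndependentSet S k = Independent G S × ∣ S ∣ ≡ k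

  ∅-independent : IndependentSet ∅ 0
  ∅-independent =
    (λ dep → let (_ , C⊆∅ , (_ , j∈C) , _) = dependent⁻ dep in ∉⊥ (C⊆∅ j∈C)) , ∣⊥∣≡0 (n G)

  -- A ghost set containing x fails at row i, which misses
  -- exactly x; one avoiding x would already be a ghost set inside S.
  extend : ∀ {S k i x} → IndependentSet S k → S ⊆ St G i → x ∉ St G i →
           IndependentSet (⁅ x ⁆ ∪ S) (suc k)
  extend {S} {i = i} {x} (indS , size) S⊆Sti x∉Sti =
    independent , ≡.trans (∣⁅x⁆∪p∣≡1+∣p∣ (x∉Sti ∘ S⊆Sti)) (cong suc size)
    where
    independent : Independent G (⁅ x ⁆ ∪ S)
    independent dep with dependent⁻ dep
    ... | C , C⊆xS , nonempty , ghost with x ∈? C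
    ...   | yes x∈C = ghost i (only⇒∣p∣≡1 (x∈p∧x∉q⇒x∈p─q x∈C x∉Sti) only-x)
      where
      only-x : ∀ {y} → y ∈ C ─ St G i → y ≡ x
      only-x y∈ with x∈p∪q⁻ ⁅ x ⁆ S (C⊆xS (p─q⊆p C (St G i) y∈))
      ... | inj₁ y∈⁅x⁆ = x∈⁅y⁆⇒x≡y x y∈⁅x⁆
      ... | inj₂ y∈S   = ⊥-elim (x∈p─q⇒x∉q y∈ (S⊆Sti y∈S))
    ...   | no  x∉C = indS (dependent⁺ C⊆S nonempty ghost)
      where
      C⊆S : C ⊆ S
      C⊆S y∈C with x∈p∪q⁻ ⁅ x ⁆ S (C⊆xS y∈C)
      ... | inj₁ y∈⁅x⁆ = ⊥-elim (x∉C (subst (_∈ C) (x∈⁅y⁆⇒x≡y x y∈⁅x⁆) y∈C))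
      ... | inj₂ y∈S   = y∈S

  singleton-independent : ∀ y → IndependentSet ⁅ y ⁆ 1
  singleton-independent y =
    subst (λ S → IndependentSet S 1) (∪-identityʳ ⁅ y ⁆)
      (extend ∅-independent (⊥-elim ∘ ∉⊥) (∉St-self y))

  separating : Sober G → ∀ {y z} → y ≢ z →
               ∃ λ x → (y ∈ St G x × z ∉ St G x) ⊎ (z ∈ St G x × y ∉ St G x)
  separating sober {y} {z} y≢z
    with ¬∀⟶∃¬ (n G) (λ x → adj G y x ≡ adj G z x) (λ x → adj G y x Bool.≟ adj G z x)
               (λ same → y≢z (sober y z (tabulate-cong same)))
  ... | x , differ with adj G y x in yx | adj G z x in zx
  ... | true  | false = x , inj₁ (St-sym (∈St⁺ yx) , ∉St⁺ zx ∘ St-sym)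
  ... | false | true  = x , inj₂ (St-sym (∈St⁺ zx) , ∉St⁺ yx ∘ St-sym)
  ... | true  | true  = ⊥-elim (differ refl)
  ... | false | false = ⊥-elim (differ refl)

  pair-independent : Sober G → ∀ {y z} → y ≢ z → IndependentSet (⁅ y ⁆ ∪ ⁅ z ⁆) 2
  pair-independent sober {y} {z} y≢z with separating sober y≢z
  ... | x , inj₁ (y∈Stx , z∉Stx) =
    subst (λ S → IndependentSet S 2) (∪-comm ⁅ z ⁆ ⁅ y ⁆)
      (extend (singleton-independent y) (⁅x⁆⊆q y∈Stx) z∉Stx)
  ... | x , inj₂ (z∈Stx , y∉Stx) = extend (singleton-independent z) (⁅x⁆⊆q z∈Stx) y∉Stx

-- Part (ii), for a sober graph in which no independent set of columns has
-- more than three elements (the upper half of c-rk G = 3).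
module CommonNeighbours {G : Graph} (sober : Sober G)
                        (small : ∀ S → Independent G S → ∣ S ∣ ≤ 3) where

  -- Two common neighbours a, b of v and w, together with a neighbour x of v
  -- outside St(w), give the independent set {v, x, a, b}: first {a, b}, then
  -- x by row w, then v by row v.
  two-common-neighbours : ∀ {v w a b x} → a ≢ b → a ∈ St G v → b ∈ St G v →
                          a ∈ St G w → b ∈ St G w → x ∈ St G v → x ∉ St G w → ⊥
  two-common-neighbours {v} a≢b av bv aw bw xv x∉w
    with extend G (extend G (pair-independent G sober a≢b) (⁅x⁆∪p⊆q aw (⁅x⁆⊆q bw)) x∉w)
                  (⁅x⁆∪p⊆q xv (⁅x⁆∪p⊆q av (⁅x⁆⊆q bv))) (∉St-self G v)
  ... | independent , size with subst (_≤ 3) size (small _ independent)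
  ...   | s≤s (s≤s (s≤s ()))

  -- Distinct vertices have at most one common neighbour: otherwise let x be
  -- adjacent to exactly one of them and apply the previous lemma.
  common-neighbours≤1 : ∀ v w → v ≢ w → ∣ St G v ∩ St G w ∣ ≤ 1
  common-neighbours≤1 v w v≢w = no-two⇒∣p∣≤1 (St G v ∩ St G w) λ a≢b a∈ b∈ →
    common (x∈p∩q⁻ _ _ a∈) (x∈p∩q⁻ _ _ b∈) a≢b (separating G sober v≢w)
    where
    common : ∀ {a b} → a ∈ St G v × a ∈ St G w → b ∈ St G v × b ∈ St G w → a ≢ b →
             ∃ (λ x → (v ∈ St G x × w ∉ St G x) ⊎ (w ∈ St G x × v ∉ St G x)) → ⊥
    common (av , aw) (bv , bw) a≢b (x , inj₁ (v∈x , w∉x)) =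
      two-common-neighbours a≢b av bv aw bw (St-sym G v∈x) (w∉x ∘ St-sym G)
    common (av , aw) (bv , bw) a≢b (x , inj₂ (w∈x , v∉x)) =
      two-common-neighbours a≢b aw bw av bv (St-sym G w∈x) (v∉x ∘ St-sym G)

module CubicGirth5 {G : Graph} (cubic : Cubic G) (girth : GirthAtLeast G 5) where

  no-four-cycle : ∀ {i k a b} → i ≢ k → a ≢ b → a ∈ St G i → b ∈ St G i →
                  a ∈ St G k → b ∈ St G k → ⊥
  no-four-cycle {i} {k} {a} {b} i≢k a≢b ai bi ak bk
    with girth (i ∷ a ∷ k ∷ b ∷ []) (s≤s (s≤s (s≤s z≤n)) , distinct , closed-walk)
    where
    distinct : Unique (i ∷ a ∷ k ∷ b ∷ [])
    distinct = (∈St⇒≢ G ai ∷ i≢k ∷ ∈St⇒≢ G bi ∷ [])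
             ∷ ((∈St⇒≢ G ak ∘ ≡.sym) ∷ a≢b ∷ [])
             ∷ (∈St⇒≢ G bk ∷ [])
             ∷ [] ∷ []
    closed-walk : Linked (Adj G) (i ∷ a ∷ k ∷ b ∷ i ∷ [])
    closed-walk = ∈St⁻ G ai ∷ ∈St⁻ G (St-sym G ak) ∷ ∈St⁻ G bk ∷ ∈St⁻ G (St-sym G bi) ∷ [-]
  ... | s≤s (s≤s (s≤s (s≤s ())))

  common-neighbours≤1 : ∀ {i k} → i ≢ k → ∣ St G i ∩ St G k ∣ ≤ 1
  common-neighbours≤1 i≢k = no-two⇒∣p∣≤1 _ λ a≢b a∈ b∈ →
    let (ai , ak) = x∈p∩q⁻ _ _ a∈ ; (bi , bk) = x∈p∩q⁻ _ _ b∈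
    in no-four-cycle i≢k a≢b ai bi ak bk

  two-neighbours : ∀ v → ∃₂ λ a b → a ≢ b × a ∈ St G v × b ∈ St G v
  two-neighbours v = 2≤∣p∣⇒distinct (St G v) (subst (2 ≤_) (≡.sym (cubic v)) (s≤s (s≤s z≤n)))

  -- Distinct vertices cannot share all three neighbours.
  sober : Sober G
  sober v w same with v ≟ w
  ... | yes v≡w = v≡w
  ... | no  v≢w =
    let (a , b , a≢b , av , bv) = two-neighbours v
    in ⊥-elim (no-four-cycle v≢w a≢b av bv (to-w av) (to-w bv))
    where
    to-w : St G v ⊆ St G w
    to-w = subst (St G v ⊆_) same id

  three-independent : Fin (n G) → ∃ λ S → IndependentSet G S 3
  three-independent v =
    let (a , b , a≢b , av , bv) = two-neighbours v
    in ⁅ v ⁆ ∪ ⁅ a ⁆ ∪ ⁅ b ⁆ ,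
       extend G (pair-independent G sober a≢b) (⁅x⁆∪p⊆q av (⁅x⁆⊆q bv)) (∉St-self G v)

  -- A full neighbourhood St(i) is a ghost set: row i misses none of it and
  -- any other row k misses at least two of its three members.
  neighbourhood-ghost : ∀ i → GhostSet G (St G i)
  neighbourhood-ghost i k with k ≟ i
  ... | yes refl = subst (_≢ 1) (≡.sym (∣p─p∣≡0 (St G k))) (λ ())
  ... | no  k≢i  = ∣p─q∣≢1 (St G i) (St G k)
    (subst (∣ St G i ∩ St G k ∣ + 2 ≤_) (≡.sym (cubic i))
      (+-monoˡ-≤ 2 (common-neighbours≤1 (k≢i ∘ ≡.sym))))

  -- If no neighbourhood lies inside S, every vertex has at most two neighbours
  -- in S, so for |S| ≥ 4 every row misses at least two members of S.
  large-ghost : ∀ S → 4 ≤ ∣ S ∣ → (∀ k → ¬ St G k ⊆ S) → GhostSet G S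
  large-ghost S big outside k = ∣p─q∣≢1 S (St G k)
    (≤-trans (+-monoˡ-≤ 2 at-most-two) big)
    where
    at-most-two : ∣ S ∩ St G k ∣ ≤ 2
    at-most-two = subst (_≤ 2) (cong ∣_∣ (∩-comm (St G k) S))
      (s≤s⁻¹ (subst (∣ St G k ∩ S ∣ <_) (cubic k) (p⊈q⇒∣p∩q∣<∣p∣ (St G k) S (outside k))))

  -- At least four columns are dependent: a ghost set is St(i) if some
  -- neighbourhood lies in S, and S itself otherwise.
  large-dependent : ∀ S → 4 ≤ ∣ S ∣ → Dependent G S
  large-dependent S big with any? (λ i → St G i ⊆? S)
  ... | yes (i , St⊆S) =
    dependent⁺ G St⊆S (1≤∣p∣⇒nonempty _ (subst (1 ≤_) (≡.sym (cubic i)) (s≤s z≤n)))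
      (neighbourhood-ghost i)
  ... | no none =
    dependent⁺ G id (1≤∣p∣⇒nonempty S (≤-trans (s≤s z≤n) big))
      (large-ghost S big (λ k St⊆S → none (k , St⊆S)))

  at-most-three : ∀ S → Independent G S → ∣ S ∣ ≤ 3
  at-most-three S independent with ∣ S ∣ ≤? 3
  ... | yes few  = few
  ... | no  many = ⊥-elim (independent (large-dependent S (≰⇒> many)))

lemma5p1 :
    ((G : Graph) → Connected G → Cubic G → GirthAtLeast G 5 →
      Sober G × CRank G 3)
    ×
    ((G : Graph) → Sober G → Connected G → CRank G 3 →
      ∀ v w → v ≢ w → ∣ St G v ∩ St G w ∣ ≤ 1)
lemma5p1 = part-i , part-ii
  where
  part-i : (G : Graph) → Connected G → Cubic G → GirthAtLeast G 5 → Sober G × CRank G 3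
  part-i G (v , _) cubic girth = sober , three-independent v , at-most-three
    where open CubicGirth5 cubic girth

  part-ii : (G : Graph) → Sober G → Connected G → CRank G 3 →
            ∀ v w → v ≢ w → ∣ St G v ∩ St G w ∣ ≤ 1
  part-ii G sober _ (_ , small) = CommonNeighbours.common-neighbours≤1 {G} sober small
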